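{- Every deterministic, strongly connected, circular graph is co-deterministic.
   Context: A graph is a non-empty set $G\subseteq V\times A\times V$ of labelled edges $s\xrightarrow{a}t$ (for some label set $A$); $V_G$ is the set of vertices occurring in edges. $G$ is deterministic if $r\xrightarrow{a}s,\ r\xrightarrow{a}t\Rightarrow s=t$; co-deterministic if $s\xrightarrow{a}r,\ t\xrightarrow{a}r\Rightarrow s=t$; strongly connected if every vertex reaches every vertex by a directed path. For a word $u=a_1\cdots a_n$, $s\xrightarrow{u}t$ means there is a path $s=s_0\xrightarrow{a_1}s_1\cdots\xrightarrow{a_n}s_n=t$; $\mathrm{L}_G(s,s)=\{u\mid s\xrightarrow{u}s\}$ is the cycle language at $s$. $G$ is circular if $\mathrm{L}_G(s,s)=\mathrm{L}_G(t,t)$ for all $s,t\in V_G$. -}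

module Defs where

open import Data.List using (List; []; _∷_)
open import Data.Product using (Σ; ∃; _×_; _,_)
open import Data.Sum using (_⊎_)
open import Relation.Binary.PropositionalEquality using (_≡_)

-- A graph with vertex type V and label set A: a set G ⊆ V × A × V of
-- labelled edges, represented as a (proof-relevant) predicate.
Graph : Set → Set → Set₁
Graph V A = V → A → V → Set

module _ {V A : Set} (G : Graph V A) where

  NonEmpty : Set
  NonEmpty = Σ V λ s → Σ A λ a → Σ V λ t → G s a t

  InV : V → Set
  InV s = Σ A λ a → Σ V λ t → G s a t ⊎ G t a s

  data Path : V → List A → V → Set where
    nil  : ∀ {s} → Path s [] s
    cons : ∀ {s a r u t} → G s a r → Path r u t → Path s (a ∷ u) t

  Deterministic : Set
  Deterministic = ∀ {r a s t} → G r a s → G r a t → s ≡ t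

  CoDeterministic : Set
  CoDeterministic = ∀ {s t a r} → G s a r → G t a r → s ≡ t

  StronglyConnected : Set
  StronglyConnected = ∀ s t → InV s → InV t → Σ (List A) λ u → Path s u t

  -- L_G(s,s) = L_G(t,t) for all s, t ∈ V_G (equality of languages as
  -- mutual inclusion)
  Circular : Set
  Circular = ∀ s t → InV s → InV t → ∀ (u : List A) →
             (Path s u s → Path t u t) × (Path t u t → Path s u s)

-- Let s --a--> r and t --a--> r be two edges into the same vertex r.
-- By strong connectivity there is a word u with r --u--> s, so a·u is a cycle
-- at s.  By circularity a·u is also a cycle at t.  Its first edge leaves t
-- with label a, so by determinism it is the edge t --a--> r, and the rest of
-- the cycle is a path r --u--> t.  Thus the word u leads from r both to s and
-- to t, and in a deterministic graph a word determines the end of a path from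
-- a given start: s = t.
module Submission where

open import Defs
open import Data.List using (_∷_)
open import Data.Product using (_,_; proj₁)
open import Data.Sum using (inj₁; inj₂)
open import Relation.Binary.PropositionalEquality using (_≡_; refl)

module _ {V A : Set} (G : Graph V A) where

  source∈V : ∀ {s a t} → G s a t → InV G s
  source∈V {a = a} {t} e = a , t , inj₁ e

  target∈V : ∀ {s a t} → G s a t → InV G t
  target∈V {s} {a} e = a , s , inj₂ e

  module _ (det : Deterministic G) where

    path-deterministic : ∀ {s u t t′} → Path G s u t → Path G s u t′ → t ≡ t′
    path-deterministic nil        nil          = refl
    path-deterministic (cons e p) (cons e′ p′) with det e e′
    ... | refl = path-deterministic p p′

    drop-first-edge : ∀ {s a r u t} → G s a r → Path G s (a ∷ u) t → Path G r u t
    drop-first-edge e (cons e′ p) with det e e′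
    ... | refl = p

lemma4p2 : {V A : Set} (G : Graph V A) → NonEmpty G → Deterministic G →
    StronglyConnected G → Circular G → CoDeterministic G
lemma4p2 G _ det sc circ {s} {t} {a} {r} s→r t→r
  with sc r s (target∈V G s→r) (source∈V G s→r)
... | u , r⇝s = path-deterministic G det r⇝s r⇝t
  where
    -- a·u is a cycle at s, hence, by circularity, a cycle at t
    cycle-at-t : Path G t (a ∷ u) t
    cycle-at-t = proj₁ (circ s t (source∈V G s→r) (source∈V G t→r) (a ∷ u))
                       (cons s→r r⇝s)

    -- its first edge must be t --a--> r, so the rest is a path r --u--> t
    r⇝t : Path G r u t
    r⇝t = drop-first-edge G det t→r cycle-at-t
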